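{- For all positive integers $n$, $$|S_n(123,132,3241)|=|S_n(132,213,2341)|=f_{n+2}-1,$$ where $f_n$ is the $n$-th Fibonacci number.
   Context: Permutations are written in one-line notation. For $\pi\in S_n$ and $\sigma\in S_k$, $\pi$ contains $\sigma$ if there are indices $1\le i_1<\dots<i_k\le n$ such that $(\pi_{i_1},\dots,\pi_{i_k})$ is order-isomorphic to $\sigma$ (i.e. $\pi_{i_a}<\pi_{i_b}$ iff $\sigma_a<\sigma_b$); otherwise $\pi$ avoids $\sigma$. $S_n(\sigma_1,\dots,\sigma_r)$ denotes the set of permutations in $S_n$ avoiding each of $\sigma_1,\dots,\sigma_r$. Fibonacci numbers: $f_1=f_2=1$, $f_n=f_{n-1}+f_{n-2}$. -}

module Defs where

open import Data.Nat using (ℕ; zero; suc; _+_)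
open import Data.Fin using (Fin; _<_; #_)
open import Data.Vec using (Vec; lookup; []; _∷_)
open import Data.Product using (Σ; ∃; _×_; proj₁)
open import Relation.Nullary using (¬_)
open import Relation.Binary.PropositionalEquality using (_≡_)
import Relation.Binary.PropositionalEquality as P
open import Relation.Binary.Bundles using (Setoid)
import Relation.Binary.Construct.On as On
open import Function.Bundles using (Inverse)
open import Level using (0ℓ)

fib : ℕ → ℕ
fib zero = zero
fib (suc zero) = suc zero
fib (suc (suc n)) = fib (suc n) + fib n

-- A word of length n over the alphabet {1,…,n}, written in one-line notation
-- (the letters 1..n are represented by Fin n = {0,…,n-1}; only order matters).
Word : ℕ → Set
Word n = Vec (Fin n) n

-- The word is a permutation iff its letters are pairwise distinct
-- (an injective map Fin n → Fin n is a bijection).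
IsPerm : ∀ {n} → Word n → Set
IsPerm {n} π = ∀ (i j : Fin n) → lookup π i ≡ lookup π j → i ≡ j

Contains : ∀ {n k} → Word n → Word k → Set
Contains {n} {k} π σ =
  Σ (Fin k → Fin n) λ e →
    (∀ a b → a < b → e a < e b) ×
    (∀ a b → (lookup π (e a) < lookup π (e b) → lookup σ a < lookup σ b)
           × (lookup σ a < lookup σ b → lookup π (e a) < lookup π (e b)))

Avoids : ∀ {n k} → Word n → Word k → Set
Avoids π σ = ¬ Contains π σ

Av₃ : ∀ {k₁ k₂ k₃} → ℕ → Word k₁ → Word k₂ → Word k₃ → Set
Av₃ n σ₁ σ₂ σ₃ =
  Σ (Word n) λ π → IsPerm π × Avoids π σ₁ × Avoids π σ₂ × Avoids π σ₃

Av₃-setoid : ∀ {k₁ k₂ k₃} → ℕ → Word k₁ → Word k₂ → Word k₃ → Setoid 0ℓ 0ℓ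
Av₃-setoid n σ₁ σ₂ σ₃ = On.setoid (P.setoid (Word n)) (proj₁ {B = λ π → IsPerm π × Avoids π σ₁ × Avoids π σ₂ × Avoids π σ₃})

HasCard : Setoid 0ℓ 0ℓ → ℕ → Set
HasCard S m = Inverse S (P.setoid (Fin m))

-- Patterns (one-line notation, letter j represented by # (j-1)).
p123 : Word 3
p123 = # 0 ∷ # 1 ∷ # 2 ∷ []

p132 : Word 3
p132 = # 0 ∷ # 2 ∷ # 1 ∷ []

p213 : Word 3
p213 = # 1 ∷ # 0 ∷ # 2 ∷ []

p3241 : Word 4
p3241 = # 2 ∷ # 1 ∷ # 3 ∷ # 0 ∷ []

p2341 : Word 4
p2341 = # 1 ∷ # 2 ∷ # 3 ∷ # 0 ∷ []

module Submission where

-- Let π be a permutation of length n ≥ 3 in either class. If n is its first entry, deleting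
-- it gives a member of the class of length n − 1; if n is its second entry, avoiding 132 forces
-- the first entry to be n − 1, and deleting both gives a member of length n − 2. Both deletions
-- are reversible because none of the five patterns can use a first letter exceeding every
-- letter from position 2 on. Otherwise n must be the last entry (by 3241, resp. 2341) and the
-- other entries decrease (by 123 and 132), resp. increase (by 132 and 213), so exactly one
-- permutation remains. Hence a(n) = a(n−1) + a(n−2) + 1 with a(1) = 1 and a(2) = 2, that is,
-- a(n) = f(n+2) − 1.

open import Defs
open import Data.Nat using (ℕ; _≤_; _∸_; _+_)
open import Data.Product using (_×_)

open import Level using (0ℓ)
open import Data.Nat using (zero; suc; _<_; _>_; z≤n; s≤s; z<s; s<s; s<s⁻¹; _≟_)
open import Data.Nat.Properties
  using (<-trans; <-asym; <-irrefl; <-cmp; ≤-trans; ≤-antisym; ≤-pred; ≤∧≢⇒<; <-≤-trans;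
         <⇒≢; <⇒≱; n≮0; n<1⇒n≡0; n<1+n; m<n⇒m<1+n; +-comm)
open import Data.Fin using (Fin; zero; suc; toℕ; fromℕ; fromℕ<; inject₁; punchOut)
  renaming (_<_ to _<ᶠ_)
import Data.Fin.Properties as Fin
open import Data.Vec using (lookup; tabulate)
import Data.Vec.Properties as Vec
open import Data.Vec.Functional using (Vector; []; _∷_; head; tail)
open import Data.Vec.Functional.Properties using (∷-cong)
open import Data.Product using (Σ; ∃; _,_; proj₁; proj₂)
open import Data.Sum using (_⊎_; inj₁; inj₂)
open import Data.Sum.Relation.Binary.Pointwise using (_⊎ₛ_; Pointwise-≡↔≡; inj₁; inj₂)
open import Data.Sum.Function.Setoid using (_⊎-inverse_)
open import Data.Empty using (⊥-elim)
open import Function using (id; _∘_; _on_; case_of_)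
open import Function.Bundles using (Inverse)
open import Function.Definitions using (Injective; Congruent; StrictlySurjective)
open import Function.Properties.Bijection using (Bijection⇒Inverse)
import Function.Consequences.Setoid as Consequences
import Function.Construct.Composition as Composition
import Function.Construct.Symmetry as Symmetry
open import Relation.Binary.Bundles using (Setoid)
open import Relation.Binary.Core using (_Preserves_⟶_)
open import Relation.Binary.Definitions using (tri<; tri≈; tri>)
import Relation.Binary.Construct.On as On
open import Relation.Binary.PropositionalEquality
  using (_≡_; _≢_; refl; sym; trans; cong; cong₂; subst; subst₂; _≗_; _→-setoid_; module ≡-Reasoning)
open import Relation.Nullary using (¬_; Dec; yes; no)
open import Relation.Nullary.Decidable using (from-yes; _→-dec_)

-- Vectors over Fin

inject₁-mono : ∀ {k} {i j : Fin k} → i <ᶠ j → inject₁ i <ᶠ inject₁ j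
inject₁-mono {i = i} {j} = subst₂ _<_ (sym (Fin.toℕ-inject₁ i)) (sym (Fin.toℕ-inject₁ j))

inject₁-reflects-< : ∀ {k} {i j : Fin k} → inject₁ i <ᶠ inject₁ j → i <ᶠ j
inject₁-reflects-< {i = i} {j} = subst₂ _<_ (Fin.toℕ-inject₁ i) (Fin.toℕ-inject₁ j)

inject₁<fromℕ : ∀ {k} (j : Fin k) → inject₁ j <ᶠ fromℕ k
inject₁<fromℕ {k} j = subst₂ _<_ (sym (Fin.toℕ-inject₁ j)) (sym (Fin.toℕ-fromℕ k)) (Fin.toℕ<n j)

fromℕ-maximal : ∀ {k} {l : Fin (suc k)} → ¬ fromℕ k <ᶠ l
fromℕ-maximal {l = l} last<l = <⇒≱ last<l (Fin.≤fromℕ l)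

last-position : ∀ {n} {p : Fin (suc n)} → (∀ {q} → ¬ p <ᶠ q) → p ≡ fromℕ n
last-position {n} {p} nothing-after with p Fin.≟ fromℕ n
... | yes p≡last = p≡last
... | no  p≢last = ⊥-elim (nothing-after (Fin.≤∧≢⇒< (Fin.≤fromℕ p) p≢last))

data InitOrLast {k} : Fin (suc k) → Set where
  inner : (j : Fin k) → InitOrLast (inject₁ j)
  last  : InitOrLast (fromℕ k)

initOrLast : ∀ {k} (i : Fin (suc k)) → InitOrLast i
initOrLast {zero}  zero    = last
initOrLast {suc k} zero    = inner zero
initOrLast {suc k} (suc i) with initOrLast i
... | inner j = inner (suc j)
... | last    = last

_∷ʳ_ : ∀ {k} → Vector ℕ k → ℕ → Vector ℕ (suc k)
_∷ʳ_ {zero}  _  x = x ∷ []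
_∷ʳ_ {suc k} xs x = head xs ∷ (tail xs ∷ʳ x)

∷ʳ-inject₁ : ∀ {k} (xs : Vector ℕ k) x j → (xs ∷ʳ x) (inject₁ j) ≡ xs j
∷ʳ-inject₁ {suc k} xs x zero    = refl
∷ʳ-inject₁ {suc k} xs x (suc j) = ∷ʳ-inject₁ (tail xs) x j

∷ʳ-fromℕ : ∀ {k} (xs : Vector ℕ k) x → (xs ∷ʳ x) (fromℕ k) ≡ x
∷ʳ-fromℕ {zero}  xs x = refl
∷ʳ-fromℕ {suc k} xs x = ∷ʳ-fromℕ (tail xs) x

∷ʳ-unique : ∀ {k} {g : Vector ℕ (suc k)} {xs x} →
            g ∘ inject₁ ≗ xs → g (fromℕ k) ≡ x → g ≗ xs ∷ʳ x
∷ʳ-unique {k} {g} {xs} {x} init≗xs last≡x i = by-position (initOrLast i)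
  where
  by-position : ∀ {i} → InitOrLast i → g i ≡ (xs ∷ʳ x) i
  by-position (inner j) = trans (init≗xs j) (sym (∷ʳ-inject₁ xs x j))
  by-position last      = trans last≡x (sym (∷ʳ-fromℕ xs x))

∷ʳ-falls : ∀ {k} {xs : Vector ℕ k} {x} → xs Preserves _<ᶠ_ ⟶ _>_ →
           ∀ {i j l} → i <ᶠ j → j <ᶠ l → (xs ∷ʳ x) j < (xs ∷ʳ x) i
∷ʳ-falls {k} {xs} {x} dec {i} {j} {l} i<j j<l = falls (initOrLast i) (initOrLast j) i<j j<l
  where
  falls : ∀ {i j} → InitOrLast i → InitOrLast j → i <ᶠ j → j <ᶠ l → (xs ∷ʳ x) j < (xs ∷ʳ x) i
  falls (inner a) (inner b) i<j _ =
    subst₂ _<_ (sym (∷ʳ-inject₁ xs x b)) (sym (∷ʳ-inject₁ xs x a)) (dec (inject₁-reflects-< i<j))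
  falls _    last _ last<l = ⊥-elim (fromℕ-maximal last<l)
  falls last _    last<j _ = ⊥-elim (fromℕ-maximal last<j)

countdown : ∀ k → Vector ℕ k
countdown zero    = []
countdown (suc k) = k ∷ countdown k

countdown-< : ∀ {k} (i : Fin k) → countdown k i < k
countdown-< {suc k} zero    = n<1+n k
countdown-< {suc k} (suc i) = m<n⇒m<1+n (countdown-< i)

countdown-decreasing : ∀ {k} → countdown k Preserves _<ᶠ_ ⟶ _>_
countdown-decreasing {suc k} {zero}  {suc j} _   = countdown-< j
countdown-decreasing {suc k} {suc i} {suc j} i<j = countdown-decreasing (s<s⁻¹ i<j)

decreasing⇒head≥ : ∀ {k} {g : Vector ℕ (suc k)} → g Preserves _<ᶠ_ ⟶ _>_ → k ≤ head g
decreasing⇒head≥ {zero}  dec = z≤n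
decreasing⇒head≥ {suc k} dec = ≤-trans (s≤s (decreasing⇒head≥ (dec ∘ s<s))) (dec {zero} {suc zero} z<s)

decreasing⇒countdown : ∀ {k} {g : Vector ℕ k} → g Preserves _<ᶠ_ ⟶ _>_ → (∀ i → g i < k) →
                       g ≗ countdown k
decreasing⇒countdown {zero}      dec bounded ()
decreasing⇒countdown {suc k} {g} dec bounded = ∷-cong head≡k (decreasing⇒countdown (dec ∘ s<s) tail<k)
  where
  head≡k : head g ≡ k
  head≡k = ≤-antisym (≤-pred (bounded zero)) (decreasing⇒head≥ dec)
  tail<k : ∀ i → tail g i < k
  tail<k i = <-≤-trans (dec z<s) (≤-pred (bounded zero))

increasing⇒last≥ : ∀ {k} {g : Vector ℕ (suc k)} → g Preserves _<ᶠ_ ⟶ _<_ → k ≤ g (fromℕ k)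
increasing⇒last≥ {zero}  inc = z≤n
increasing⇒last≥ {suc k} inc =
  ≤-trans (s≤s (increasing⇒last≥ (inc ∘ inject₁-mono))) (inc (inject₁<fromℕ (fromℕ k)))

increasing⇒toℕ : ∀ {k} {g : Vector ℕ k} → g Preserves _<ᶠ_ ⟶ _<_ → (∀ i → g i < k) → g ≗ toℕ
increasing⇒toℕ {zero}      inc bounded ()
increasing⇒toℕ {suc k} {g} inc bounded i = by-position (initOrLast i)
  where
  init≗toℕ : g ∘ inject₁ ≗ toℕ
  init≗toℕ = increasing⇒toℕ (inc ∘ inject₁-mono)
               (λ j → <-≤-trans (inc (inject₁<fromℕ j)) (≤-pred (bounded (fromℕ k))))
  by-position : ∀ {i} → InitOrLast i → g i ≡ toℕ i
  by-position (inner j) = trans (init≗toℕ j) (sym (Fin.toℕ-inject₁ j))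
  by-position last      =
    trans (≤-antisym (≤-pred (bounded _)) (increasing⇒last≥ inc)) (sym (Fin.toℕ-fromℕ k))

-- Permutations as vectors

record IsPermutation {n} (f : Vector ℕ n) : Set where
  field
    injective : Injective _≡_ _≡_ f
    bounded   : ∀ i → f i < n

open IsPermutation

compare : ∀ {n} {f : Vector ℕ n} → IsPermutation f → ∀ {i j} → i <ᶠ j → f i < f j ⊎ f j < f i
compare {f = f} perm {i} {j} i<j with <-cmp (f i) (f j)
... | tri< fi<fj _ _ = inj₁ fi<fj
... | tri≈ _ fi≡fj _ = ⊥-elim (Fin.<⇒≢ i<j (injective perm fi≡fj))
... | tri> _ _ fj<fi = inj₂ fj<fi

attains : ∀ {n} {f : Vector ℕ n} → IsPermutation f → ∀ {v} → v < n → ∃ λ i → f i ≡ v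
attains {suc n} {f} perm {v} v<n with Fin.any? (λ i → f i ≟ v)
... | yes found  = found
... | no missing = ⊥-elim (<-irrefl refl (Fin.injective⇒≤ g-injective))
  where
  f′ : Fin (suc n) → Fin (suc n)
  f′ i = fromℕ< (bounded perm i)
  v≢f′ : ∀ i → fromℕ< v<n ≢ f′ i
  v≢f′ i eq = missing (i , sym (Fin.fromℕ<-injective _ _ v<n (bounded perm i) eq))
  g : Fin (suc n) → Fin n
  g i = punchOut (v≢f′ i)
  g-injective : Injective _≡_ _≡_ g
  g-injective eq = injective perm (Fin.fromℕ<-injective _ _ (bounded perm _) (bounded perm _)
                     (Fin.punchOut-injective (v≢f′ _) (v≢f′ _) eq))

module _ {n} {f : Vector ℕ (suc n)} (perm : IsPermutation f) where

  below-max : ∀ {p} → f p ≡ n → ∀ {i} → i ≢ p → f i < n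
  below-max fp i≢p =
    ≤∧≢⇒< (≤-pred (bounded perm _)) (λ fi≡n → i≢p (injective perm (trans fi≡n (sym fp))))

  tail-isPermutation : head f ≡ n → IsPermutation (tail f)
  tail-isPermutation f₀ = record
    { injective = Fin.suc-injective ∘ injective perm
    ; bounded   = λ i → below-max f₀ λ ()
    }

tail²-isPermutation : ∀ {n} {f : Vector ℕ (2 + n)} → IsPermutation f →
                      f zero ≡ n → f (suc zero) ≡ suc n → IsPermutation (tail (tail f))
tail²-isPermutation perm f₀ f₁ = record
  { injective = Fin.suc-injective ∘ Fin.suc-injective ∘ injective perm
  ; bounded   = λ i → ≤∧≢⇒< (≤-pred (below-max perm f₁ λ ()))
                        (λ fᵢ≡n → case injective perm (trans fᵢ≡n (sym f₀)) of λ ())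
  }

late-max-position : ∀ {m} {f : Vector ℕ (3 + m)} → IsPermutation f →
                    f zero ≢ 2 + m → f (suc zero) ≢ 2 + m → ∃ λ p → f (suc (suc p)) ≡ 2 + m
late-max-position perm f₀ f₁ with attains perm (n<1+n _)
... | zero        , fp = ⊥-elim (f₀ fp)
... | suc zero    , fp = ⊥-elim (f₁ fp)
... | suc (suc p) , fp = p , fp

separated⇒injective : ∀ {n} {g : Vector ℕ n} → (∀ {i j} → i <ᶠ j → g i ≢ g j) → Injective _≡_ _≡_ g
separated⇒injective separated {i} {j} gi≡gj with Fin.<-cmp i j
... | tri< i<j _ _ = ⊥-elim (separated i<j gi≡gj)
... | tri≈ _ i≡j _ = i≡j
... | tri> _ _ j<i = ⊥-elim (separated j<i (sym gi≡gj))

fresh-∷-injective : ∀ {n x} {g : Vector ℕ n} → (∀ i → g i ≢ x) → Injective _≡_ _≡_ g →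
                    Injective _≡_ _≡_ (x ∷ g)
fresh-∷-injective fresh inj {zero}  {zero}  _  = refl
fresh-∷-injective fresh inj {zero}  {suc j} eq = ⊥-elim (fresh j (sym eq))
fresh-∷-injective fresh inj {suc i} {zero}  eq = ⊥-elim (fresh i eq)
fresh-∷-injective fresh inj {suc i} {suc j} eq = cong suc (inj eq)

[]-isPermutation : IsPermutation []
[]-isPermutation = record { injective = λ { {()} } ; bounded = λ () }

∷-isPermutation : ∀ {n} {g : Vector ℕ n} → IsPermutation g → IsPermutation (n ∷ g)
∷-isPermutation perm = record
  { injective = fresh-∷-injective (λ i → <⇒≢ (bounded perm i)) (injective perm)
  ; bounded   = λ { zero → n<1+n _ ; (suc i) → m<n⇒m<1+n (bounded perm i) }
  }

∷∷-isPermutation : ∀ {n} {g : Vector ℕ n} → IsPermutation g → IsPermutation (n ∷ suc n ∷ g)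
∷∷-isPermutation {n} perm = record
  { injective = fresh-∷-injective n-fresh
                  (fresh-∷-injective (λ i → <⇒≢ (m<n⇒m<1+n (bounded perm i))) (injective perm))
  ; bounded   = λ { zero          → m<n⇒m<1+n (n<1+n n)
                  ; (suc zero)    → n<1+n (suc n)
                  ; (suc (suc i)) → m<n⇒m<1+n (m<n⇒m<1+n (bounded perm i)) }
  }
  where
  n-fresh : ∀ i → (suc n ∷ _) i ≢ n
  n-fresh zero    = λ ()
  n-fresh (suc i) = <⇒≢ (bounded perm i)

∷ʳ-isPermutation : ∀ {k} {xs : Vector ℕ k} → IsPermutation xs → IsPermutation (xs ∷ʳ k)
∷ʳ-isPermutation {k} {xs} perm = record
  { injective = separated⇒injective λ {i} {j} → separated (initOrLast i) (initOrLast j)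
  ; bounded   = λ i → bounded′ (initOrLast i)
  }
  where
  separated : ∀ {i j} → InitOrLast i → InitOrLast j → i <ᶠ j → (xs ∷ʳ k) i ≢ (xs ∷ʳ k) j
  separated (inner a) (inner b) i<j eq = Fin.<⇒≢ (inject₁-reflects-< i<j)
    (injective perm (trans (sym (∷ʳ-inject₁ xs k a)) (trans eq (∷ʳ-inject₁ xs k b))))
  separated (inner a) last _ eq =
    <⇒≢ (bounded perm a) (trans (sym (∷ʳ-inject₁ xs k a)) (trans eq (∷ʳ-fromℕ xs k)))
  separated last _ last<j = ⊥-elim (fromℕ-maximal last<j)
  bounded′ : ∀ {i} → InitOrLast i → (xs ∷ʳ k) i < suc k
  bounded′ (inner a) = subst (_< suc k) (sym (∷ʳ-inject₁ xs k a)) (m<n⇒m<1+n (bounded perm a))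
  bounded′ last      = subst (_< suc k) (sym (∷ʳ-fromℕ xs k)) (n<1+n k)

countdown-isPermutation : ∀ {k} → IsPermutation (countdown k)
countdown-isPermutation = record
  { injective = separated⇒injective λ i<j → <⇒≢ (countdown-decreasing i<j) ∘ sym
  ; bounded   = countdown-<
  }

toℕ-isPermutation : ∀ {n} → IsPermutation (toℕ {n})
toℕ-isPermutation = record { injective = Fin.toℕ-injective ; bounded = Fin.toℕ<n }

values : ∀ {n} → Word n → Vector ℕ n
values π = toℕ ∘ lookup π

values-isPermutation : ∀ {n} {π : Word n} → IsPerm π → IsPermutation (values π)
values-isPermutation {π = π} π-perm = record
  { injective = π-perm _ _ ∘ Fin.toℕ-injective
  ; bounded   = Fin.toℕ<n ∘ lookup π
  }

values-injective : ∀ {n} {π π′ : Word n} → values π ≗ values π′ → π ≡ π′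
values-injective {π = π} {π′} eq = begin
  π                    ≡⟨ Vec.tabulate∘lookup π ⟨
  tabulate (lookup π)  ≡⟨ Vec.tabulate-cong (Fin.toℕ-injective ∘ eq) ⟩
  tabulate (lookup π′) ≡⟨ Vec.tabulate∘lookup π′ ⟩
  π′                   ∎
  where open ≡-Reasoning

module _ {n} {f : Vector ℕ n} (perm : IsPermutation f) where

  toWord : Word n
  toWord = tabulate (λ i → fromℕ< (bounded perm i))

  values-toWord : values toWord ≗ f
  values-toWord i = trans (cong toℕ (Vec.lookup∘tabulate _ i)) (Fin.toℕ-fromℕ< _)

  toWord-isPerm : IsPerm toWord
  toWord-isPerm i j eq =
    injective perm (trans (sym (values-toWord i)) (trans (cong toℕ eq) (values-toWord j)))

-- Pattern occurrences

record Occurs {k n} (σ : Word k) (f : Vector ℕ n) : Set where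
  constructor occurrence
  field
    positions  : Vector (Fin n) k
    increasing : positions Preserves _<ᶠ_ ⟶ _<ᶠ_
    like-σ     : (f ∘ positions) Preserves (_<ᶠ_ on lookup σ) ⟶ _<_

contains⇒occurs : ∀ {k n} {π : Word n} {σ : Word k} → Contains π σ → Occurs σ (values π)
contains⇒occurs (e , mono , iso) = occurrence e (mono _ _) (proj₂ (iso _ _))

occurs⇒contains : ∀ {k n} {π : Word n} {σ : Word k} → IsPerm σ → Occurs σ (values π) → Contains π σ
occurs⇒contains {π = π} {σ} σ-perm (occurrence e mono ord) =
  e , (λ _ _ → mono) , λ a b → reflect a b , ord
  where
  reflect : ∀ a b → lookup π (e a) <ᶠ lookup π (e b) → lookup σ a <ᶠ lookup σ b
  reflect a b πa<πb with Fin.<-cmp (lookup σ a) (lookup σ b)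
  ... | tri< σa<σb _ _ = σa<σb
  ... | tri≈ _ σa≡σb _ = ⊥-elim (<-irrefl (cong (values π ∘ e) (σ-perm a b σa≡σb)) πa<πb)
  ... | tri> _ _ σb<σa = ⊥-elim (<-asym πa<πb (ord σb<σa))

isPerm? : ∀ {k} (σ : Word k) → Dec (IsPerm σ)
isPerm? σ = Fin.all? λ i → Fin.all? λ j → (lookup σ i Fin.≟ lookup σ j) →-dec (i Fin.≟ j)

steps⇒increasing : ∀ {k} (g : Vector ℕ (suc k)) → (∀ a → g (inject₁ a) < g (suc a)) →
                   g Preserves _<ᶠ_ ⟶ _<_
steps⇒increasing g step {zero} {suc zero} _ = step zero
steps⇒increasing {suc k} g step {zero} {suc (suc b)} _ =
  <-trans (step zero) (steps⇒increasing (tail g) (step ∘ suc) {zero} {suc b} z<s)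
steps⇒increasing {suc k} g step {suc a} {suc b} a<b =
  steps⇒increasing (tail g) (step ∘ suc) (s<s⁻¹ a<b)

-- e lists the positions of the occurrence in order of increasing value.
occurs-via : ∀ {k n} (σ : Word (suc k)) {f : Vector ℕ n} (e : Vector (Fin n) (suc k)) →
             (∀ a → e (lookup σ (inject₁ a)) <ᶠ e (lookup σ (suc a))) →
             (∀ r → f (e (inject₁ r)) < f (e (suc r))) → Occurs σ f
occurs-via σ {f} e positions-rise values-rise = occurrence (e ∘ lookup σ)
  (steps⇒increasing (toℕ ∘ e ∘ lookup σ) positions-rise) (steps⇒increasing (f ∘ e) values-rise)

module _ {n} {f : Vector ℕ n} {x y z : Fin n} (x<y : x <ᶠ y) (y<z : y <ᶠ z) where

  occurs-123 : f x < f y → f y < f z → Occurs p123 f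
  occurs-123 v₁ v₂ = occurs-via p123 (x ∷ y ∷ z ∷ [])
    (λ { zero → x<y ; (suc zero) → y<z }) (λ { zero → v₁ ; (suc zero) → v₂ })

  occurs-132 : f x < f z → f z < f y → Occurs p132 f
  occurs-132 v₁ v₂ = occurs-via p132 (x ∷ z ∷ y ∷ [])
    (λ { zero → x<y ; (suc zero) → y<z }) (λ { zero → v₁ ; (suc zero) → v₂ })

  occurs-213 : f y < f x → f x < f z → Occurs p213 f
  occurs-213 v₁ v₂ = occurs-via p213 (y ∷ x ∷ z ∷ [])
    (λ { zero → x<y ; (suc zero) → y<z }) (λ { zero → v₁ ; (suc zero) → v₂ })

  module _ {w : Fin n} (z<w : z <ᶠ w) where

    occurs-3241 : f w < f y → f y < f x → f x < f z → Occurs p3241 f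
    occurs-3241 v₁ v₂ v₃ = occurs-via p3241 (w ∷ y ∷ x ∷ z ∷ [])
      (λ { zero → x<y ; (suc zero) → y<z ; (suc (suc zero)) → z<w })
      (λ { zero → v₁ ; (suc zero) → v₂ ; (suc (suc zero)) → v₃ })

    occurs-2341 : f w < f x → f x < f y → f y < f z → Occurs p2341 f
    occurs-2341 v₁ v₂ v₃ = occurs-via p2341 (w ∷ x ∷ y ∷ z ∷ [])
      (λ { zero → x<y ; (suc zero) → y<z ; (suc (suc zero)) → z<w })
      (λ { zero → v₁ ; (suc zero) → v₂ ; (suc (suc zero)) → v₃ })

occurs-resp : ∀ {k n} {σ : Word k} {f g : Vector ℕ n} → f ≗ g → Occurs σ f → Occurs σ g
occurs-resp f≗g (occurrence e mono ord) =
  occurrence e mono λ {a} {b} σa<σb → subst₂ _<_ (f≗g (e a)) (f≗g (e b)) (ord σa<σb)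

tail-occurs⇒occurs : ∀ {k n} {σ : Word k} {f : Vector ℕ (suc n)} → Occurs σ (tail f) → Occurs σ f
tail-occurs⇒occurs (occurrence e mono ord) = occurrence (suc ∘ e) (s<s ∘ mono) ord

third-position≥2 : ∀ {k n} {e : Vector (Fin n) (3 + k)} → e Preserves _<ᶠ_ ⟶ _<ᶠ_ →
                   2 ≤ toℕ (e (suc (suc zero)))
third-position≥2 mono = ≤-trans (s≤s (≤-trans z<s (mono {zero} {suc zero} z<s))) (mono (s<s z<s))

occurs⇒3≤length : ∀ {k n} {σ : Word (3 + k)} {f : Vector ℕ n} → Occurs σ f → 3 ≤ n
occurs⇒3≤length (occurrence _ mono _) = <-≤-trans (s≤s (third-position≥2 mono)) (Fin.toℕ<n _)

HeadBelowThird : ∀ {k} → Word (3 + k) → Set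
HeadBelowThird σ = lookup σ zero <ᶠ lookup σ (suc (suc zero))

occurs⇒tail-occurs : ∀ {k n} {σ : Word (3 + k)} {f : Vector ℕ (suc n)} → HeadBelowThird σ →
                     (∀ i → 2 ≤ toℕ i → f i < head f) → Occurs σ f → Occurs σ (tail f)
occurs⇒tail-occurs {f = f} σ₀<σ₂ dominant (occurrence e mono ord) = occurrence e′ mono′ ord′
  where
  e₀≢0 : zero ≢ e zero
  e₀≢0 0≡e₀ = <-asym (ord σ₀<σ₂)
    (subst (λ i → f (e (suc (suc zero))) < f i) 0≡e₀ (dominant _ (third-position≥2 mono)))
  e≢0 : ∀ a → zero ≢ e a
  e≢0 zero    = e₀≢0
  e≢0 (suc a) 0≡eₐ = n≮0 (subst (λ i → toℕ (e zero) < toℕ i) (sym 0≡eₐ) (mono z<s))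
  e′ : Vector (Fin _) _
  e′ a = punchOut (e≢0 a)
  suc-e′ : ∀ a → suc (e′ a) ≡ e a
  suc-e′ a = Fin.punchIn-punchOut (e≢0 a)
  mono′ : e′ Preserves _<ᶠ_ ⟶ _<ᶠ_
  mono′ {a} {b} a<b = s<s⁻¹ (subst₂ _<ᶠ_ (sym (suc-e′ a)) (sym (suc-e′ b)) (mono a<b))
  ord′ : (tail f ∘ e′) Preserves _ ⟶ _<_
  ord′ {a} {b} σa<σb = subst₂ _<_ (cong f (sym (suc-e′ a))) (cong f (sym (suc-e′ b))) (ord σa<σb)

non-final-ascent-avoided : ∀ {k n} {σ : Word k} {f : Vector ℕ n} →
  (∀ {i j l} → i <ᶠ j → j <ᶠ l → f j < f i) →
  ∀ {a b c} → a <ᶠ b → b <ᶠ c → lookup σ a <ᶠ lookup σ b → ¬ Occurs σ f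
non-final-ascent-avoided falls a<b b<c σa<σb (occurrence e mono ord) =
  <-asym (ord σa<σb) (falls (mono a<b) (mono b<c))

descent-avoided : ∀ {k n} {σ : Word k} {f : Vector ℕ n} → f Preserves _<ᶠ_ ⟶ _<_ →
  ∀ {a b} → a <ᶠ b → lookup σ b <ᶠ lookup σ a → ¬ Occurs σ f
descent-avoided inc a<b σb<σa (occurrence e mono ord) = <-asym (ord σb<σa) (inc (mono a<b))

-- Setoids and cardinalities

Vectors : ∀ n → (Vector ℕ n → Set) → Setoid 0ℓ 0ℓ
Vectors n P = On.setoid (Fin n →-setoid ℕ) (proj₁ {B = P})

module _ {S T : Setoid 0ℓ 0ℓ} where
  open Setoid S using () renaming (Carrier to A; _≈_ to _≈₁_)
  open Setoid T using () renaming (Carrier to B; _≈_ to _≈₂_)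

  bijective⇒inverse : (f : A → B) → Congruent _≈₁_ _≈₂_ f → Injective _≈₁_ _≈₂_ f →
                      StrictlySurjective _≈₂_ f → Inverse S T
  bijective⇒inverse f f-cong f-injective f-surjective = Bijection⇒Inverse record
    { to        = f
    ; cong      = f-cong
    ; bijective = f-injective , Consequences.strictlySurjective⇒surjective S T f-cong f-surjective
    }

  HasCard-⊎ : ∀ {a b} → HasCard S a → HasCard T b → HasCard (S ⊎ₛ T) (a + b)
  HasCard-⊎ S≅a T≅b = Composition.inverse (S≅a ⊎-inverse T≅b)
    (Composition.inverse (Pointwise-≡↔≡ _ _) (Symmetry.inverse Fin.+↔⊎))

module _ {S : Setoid 0ℓ 0ℓ} where
  open Setoid S using (Carrier; _≈_) renaming (refl to ≈-refl; sym to ≈-sym)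

  HasCard-empty : ¬ Carrier → HasCard S 0
  HasCard-empty empty = record
    { to        = ⊥-elim ∘ empty
    ; from      = λ ()
    ; to-cong   = λ {x} → ⊥-elim (empty x)
    ; from-cong = λ { {()} }
    ; inverse   = (λ { {()} }) , λ {x} → ⊥-elim (empty x)
    }

  HasCard-singleton : (c : Carrier) → (∀ x → x ≈ c) → HasCard S 1
  HasCard-singleton c center = record
    { to        = λ _ → zero
    ; from      = λ _ → c
    ; to-cong   = λ _ → refl
    ; from-cong = λ _ → ≈-refl
    ; inverse   = (λ { {zero} _ → refl }) , λ {x} _ → ≈-sym (center x)
    }

lateCount : ℕ → ℕ
lateCount zero    = 0
lateCount (suc _) = 1

count : ℕ → ℕ
count zero          = 1
count (suc zero)    = 1
count (suc (suc m)) = count (suc m) + (count m + lateCount m)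

suc-count≡fib : ∀ k → suc (count (suc k)) ≡ fib (3 + k)
suc-count≡fib zero          = refl
suc-count≡fib (suc zero)    = refl
suc-count≡fib (suc (suc k)) =
  trans (cong (λ x → suc (count (2 + k) + x)) (+-comm (count (suc k)) 1))
        (cong₂ _+_ (suc-count≡fib (suc k)) (suc-count≡fib k))

count≡fib∸1 : ∀ k → count (suc k) ≡ fib (suc k + 2) ∸ 1
count≡fib∸1 k = trans (cong (_∸ 1) (suc-count≡fib k)) (cong (λ x → fib (suc x) ∸ 1) (+-comm 2 k))

-- Classes of permutations avoiding three patterns

module AvoidanceClass {k₁ k₂ k₃} (σ₁ : Word (3 + k₁)) (σ₂ : Word (3 + k₂)) (σ₃ : Word (3 + k₃))
  (σ₁-perm : IsPerm σ₁) (σ₂-perm : IsPerm σ₂) (σ₃-perm : IsPerm σ₃)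
  (σ₁-head : HeadBelowThird σ₁) (σ₂-head : HeadBelowThird σ₂) (σ₃-head : HeadBelowThird σ₃)
  where

  Avoiding : ∀ {n} → Vector ℕ n → Set
  Avoiding f = ¬ Occurs σ₁ f × ¬ Occurs σ₂ f × ¬ Occurs σ₃ f

  Good : ∀ {n} → Vector ℕ n → Set
  Good f = IsPermutation f × Avoiding f

  Avoiders : ℕ → Setoid 0ℓ 0ℓ
  Avoiders n = Vectors n Good

  LateMax : ℕ → Setoid 0ℓ 0ℓ
  LateMax m = Vectors (2 + m) λ f → Good f × f zero ≢ suc m × f (suc zero) ≢ suc m

  avoiding-resp : ∀ {n} {f g : Vector ℕ n} → f ≗ g → Avoiding f → Avoiding g
  avoiding-resp {f = f} {g} f≗g (¬o₁ , ¬o₂ , ¬o₃) =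
    ¬o₁ ∘ occurs-resp g≗f , ¬o₂ ∘ occurs-resp g≗f , ¬o₃ ∘ occurs-resp g≗f
    where
    g≗f : g ≗ f
    g≗f i = sym (f≗g i)

  short-avoiding : ∀ {n} {f : Vector ℕ n} → n < 3 → Avoiding f
  short-avoiding n<3 = too-long , too-long , too-long
    where
    too-long : ∀ {k} {σ : Word (3 + k)} → ¬ Occurs σ _
    too-long = <⇒≱ n<3 ∘ occurs⇒3≤length

  tail-avoiding : ∀ {n} {f : Vector ℕ (suc n)} → Avoiding f → Avoiding (tail f)
  tail-avoiding (¬o₁ , ¬o₂ , ¬o₃) =
    ¬o₁ ∘ tail-occurs⇒occurs , ¬o₂ ∘ tail-occurs⇒occurs , ¬o₃ ∘ tail-occurs⇒occurs

  dominant-head-avoiding : ∀ {n} {f : Vector ℕ (suc n)} → (∀ i → 2 ≤ toℕ i → f i < head f) →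
                           Avoiding (tail f) → Avoiding f
  dominant-head-avoiding dominant (¬o₁ , ¬o₂ , ¬o₃) =
    ¬o₁ ∘ occurs⇒tail-occurs σ₁-head dominant ,
    ¬o₂ ∘ occurs⇒tail-occurs σ₂-head dominant ,
    ¬o₃ ∘ occurs⇒tail-occurs σ₃-head dominant

  avoids⇒avoiding : ∀ {n} {π : Word n} → Avoids π σ₁ × Avoids π σ₂ × Avoids π σ₃ → Avoiding (values π)
  avoids⇒avoiding {π = π} (¬c₁ , ¬c₂ , ¬c₃) =
    ¬c₁ ∘ occurs⇒contains {π = π} σ₁-perm ,
    ¬c₂ ∘ occurs⇒contains {π = π} σ₂-perm ,
    ¬c₃ ∘ occurs⇒contains {π = π} σ₃-perm

  avoiding⇒avoids : ∀ {n} {π : Word n} → Avoiding (values π) → Avoids π σ₁ × Avoids π σ₂ × Avoids π σ₃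
  avoiding⇒avoids {π = π} (¬o₁ , ¬o₂ , ¬o₃) =
    ¬o₁ ∘ contains⇒occurs {π = π} , ¬o₂ ∘ contains⇒occurs {π = π} , ¬o₃ ∘ contains⇒occurs {π = π}

  []-good : Good []
  []-good = []-isPermutation , short-avoiding z<s

  ∷-good : ∀ {n} {g : Vector ℕ n} → Good g → Good (n ∷ g)
  ∷-good (perm , avoiding) =
    ∷-isPermutation perm , dominant-head-avoiding (λ { (suc i) _ → bounded perm i }) avoiding

  ∷∷-good : ∀ {n} {g : Vector ℕ n} → Good g → Good (n ∷ suc n ∷ g)
  ∷∷-good (perm , avoiding) = ∷∷-isPermutation perm ,
    dominant-head-avoiding (λ { (suc zero) (s≤s ()) ; (suc (suc i)) _ → bounded perm i })
      (dominant-head-avoiding (λ { (suc i) _ → m<n⇒m<1+n (bounded perm i) }) avoiding)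

  tail-good : ∀ {n} {f : Vector ℕ (suc n)} → Good f → head f ≡ n → Good (tail f)
  tail-good (perm , avoiding) f₀ = tail-isPermutation perm f₀ , tail-avoiding avoiding

  tail²-good : ∀ {n} {f : Vector ℕ (2 + n)} → Good f → f zero ≡ n → f (suc zero) ≡ suc n →
               Good (tail (tail f))
  tail²-good (perm , avoiding) f₀ f₁ =
    tail²-isPermutation perm f₀ f₁ , tail-avoiding (tail-avoiding avoiding)

  Av₃≅Avoiders : ∀ n → Inverse (Av₃-setoid n σ₁ σ₂ σ₃) (Avoiders n)
  Av₃≅Avoiders n =
    bijective⇒inverse to (λ π≡π′ i → cong (λ π → values π i) π≡π′) values-injective surjective
    where
    to : Av₃ n σ₁ σ₂ σ₃ → Σ (Vector ℕ n) Good
    to (π , π-perm , avoids) =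
      values π , values-isPermutation {π = π} π-perm , avoids⇒avoiding {π = π} avoids
    surjective : StrictlySurjective (Setoid._≈_ (Avoiders n)) to
    surjective (f , perm , avoiding) =
      (toWord perm , toWord-isPerm perm ,
       avoiding⇒avoids {π = toWord perm} (avoiding-resp (sym ∘ values-toWord perm) avoiding)) ,
      values-toWord perm

  lateMax-0-empty : ¬ Setoid.Carrier (LateMax 0)
  lateMax-0-empty (f , (perm , _) , f₀ , f₁) with attains perm (n<1+n 1)
  ... | zero     , fp = f₀ fp
  ... | suc zero , fp = f₁ fp

  module Counting (avoiding⇒¬132 : ∀ {n} {f : Vector ℕ n} → Avoiding f → ¬ Occurs p132 f) where

    max-second⇒first : ∀ {m} {f : Vector ℕ (2 + m)} → Good f → f (suc zero) ≡ suc m → f zero ≡ m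
    max-second⇒first {m} {f} (perm , avoiding) f₁ with attains perm (m<n⇒m<1+n (n<1+n m))
    ... | zero        , f₀ = f₀
    ... | suc zero    , fq = ⊥-elim (<-irrefl (trans (sym fq) f₁) (n<1+n m))
    ... | suc (suc q) , fq with compare perm {zero} {suc (suc q)} z<s
    ...   | inj₁ f₀<fq = ⊥-elim (avoiding⇒¬132 avoiding
              (occurs-132 {f = f} {zero} {suc zero} z<s (s<s z<s) f₀<fq
                (subst₂ _<_ (sym fq) (sym f₁) (n<1+n m))))
    ...   | inj₂ fq<f₀ = ⊥-elim (<⇒≱ (subst (_< f zero) fq fq<f₀) (≤-pred (below-max perm f₁ λ ())))

    module _ (m : ℕ) where

      Parts : Setoid 0ℓ 0ℓ
      Parts = Avoiders (suc m) ⊎ₛ (Avoiders m ⊎ₛ LateMax m)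

      open Setoid Parts using () renaming (Carrier to Part; _≈_ to _≈ₚ_)
      open Setoid (Avoiders (2 + m)) using () renaming (Carrier to Whole; _≈_ to _≈_)

      assemble : Part → Whole
      assemble (inj₁ (g , G))            = suc m ∷ g , ∷-good G
      assemble (inj₂ (inj₁ (g , G)))     = m ∷ suc m ∷ g , ∷∷-good G
      assemble (inj₂ (inj₂ (f , G , _))) = f , G

      assemble-cong : Congruent _≈ₚ_ _≈_ assemble
      assemble-cong (inj₁ g≗g′)        = ∷-cong refl g≗g′
      assemble-cong (inj₂ (inj₁ g≗g′)) = ∷-cong refl (∷-cong refl g≗g′)
      assemble-cong (inj₂ (inj₂ f≗f′)) = f≗f′

      assemble-injective : Injective _≈ₚ_ _≈_ assemble
      assemble-injective {inj₁ _}        {inj₁ _}        eq = inj₁ (eq ∘ suc)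
      assemble-injective {inj₁ _}        {inj₂ (inj₁ _)} eq = ⊥-elim (<-irrefl (sym (eq zero)) (n<1+n m))
      assemble-injective {inj₁ _}        {inj₂ (inj₂ (_ , _ , f₀ , _))} eq = ⊥-elim (f₀ (sym (eq zero)))
      assemble-injective {inj₂ (inj₁ _)} {inj₁ _}        eq = ⊥-elim (<-irrefl (eq zero) (n<1+n m))
      assemble-injective {inj₂ (inj₁ _)} {inj₂ (inj₁ _)} eq = inj₂ (inj₁ λ i → eq (suc (suc i)))
      assemble-injective {inj₂ (inj₁ _)} {inj₂ (inj₂ (_ , _ , _ , f₁))} eq = ⊥-elim (f₁ (sym (eq (suc zero))))
      assemble-injective {inj₂ (inj₂ (_ , _ , f₀ , _))} {inj₁ _}        eq = ⊥-elim (f₀ (eq zero))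
      assemble-injective {inj₂ (inj₂ (_ , _ , _ , f₁))} {inj₂ (inj₁ _)} eq = ⊥-elim (f₁ (eq (suc zero)))
      assemble-injective {inj₂ (inj₂ _)} {inj₂ (inj₂ _)} eq = inj₂ (inj₂ eq)

      assemble-surjective : StrictlySurjective _≈_ assemble
      assemble-surjective (f , G) with f zero ≟ suc m | f (suc zero) ≟ suc m
      ... | yes f₀ | _      = inj₁ (tail f , tail-good G f₀) , ∷-cong (sym f₀) (λ _ → refl)
      ... | no _   | yes f₁ = inj₂ (inj₁ (tail (tail f) , tail²-good G f₀ f₁)) ,
                              ∷-cong (sym f₀) (∷-cong (sym f₁) (λ _ → refl))
        where
        f₀ : f zero ≡ m
        f₀ = max-second⇒first G f₁
      ... | no f₀  | no f₁  = inj₂ (inj₂ (f , G , f₀ , f₁)) , λ _ → refl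

      decomposition : Inverse (Avoiders (2 + m)) Parts
      decomposition = Symmetry.inverse
        (bijective⇒inverse assemble assemble-cong assemble-injective assemble-surjective)

    Avoiders-card : (∀ m → HasCard (LateMax (suc m)) 1) → ∀ n → HasCard (Avoiders n) (count n)
    Avoiders-card late-card zero          = HasCard-singleton ([] , []-good) λ _ ()
    Avoiders-card late-card (suc zero)    = HasCard-singleton (0 ∷ [] , ∷-good []-good)
      λ { (f , perm , _) zero → n<1⇒n≡0 (bounded perm zero) }
    Avoiders-card late-card (suc (suc m)) = Composition.inverse (decomposition m)
      (HasCard-⊎ (Avoiders-card late-card (suc m))
                 (HasCard-⊎ (Avoiders-card late-card m) (LateMax-card m)))
      where
      LateMax-card : ∀ m → HasCard (LateMax m) (lateCount m)
      LateMax-card zero    = HasCard-empty lateMax-0-empty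
      LateMax-card (suc m) = late-card m

    Av₃-card : (∀ m → HasCard (LateMax (suc m)) 1) →
               ∀ n → HasCard (Av₃-setoid n σ₁ σ₂ σ₃) (count n)
    Av₃-card late-card n = Composition.inverse (Av₃≅Avoiders n) (Avoiders-card late-card n)

-- S_n(123, 132, 3241)

module Class₁ = AvoidanceClass p123 p132 p3241
  (from-yes (isPerm? p123)) (from-yes (isPerm? p132)) (from-yes (isPerm? p3241))
  z<s z<s (s<s (s<s z<s))

forced₁ : ∀ m → Vector ℕ (3 + m)
forced₁ m = countdown (2 + m) ∷ʳ (2 + m)

forced₁-lateMax : ∀ m → Class₁.Good (forced₁ m) ×
                  forced₁ m zero ≢ 2 + m × forced₁ m (suc zero) ≢ 2 + m
forced₁-lateMax m =
  (∷ʳ-isPermutation countdown-isPermutation ,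
   non-final-ascent-avoided falls {zero} {suc zero} {suc (suc zero)} z<s (s<s z<s) z<s ,
   non-final-ascent-avoided falls {zero} {suc zero} {suc (suc zero)} z<s (s<s z<s) z<s ,
   non-final-ascent-avoided falls {zero} {suc (suc zero)} {suc (suc (suc zero))}
     z<s (s<s (s<s z<s)) (s<s (s<s z<s))) ,
  (λ ()) , (λ ())
  where
  falls : ∀ {i j l} → i <ᶠ j → j <ᶠ l → forced₁ m j < forced₁ m i
  falls = ∷ʳ-falls countdown-decreasing

lateMax₁⇒forced₁ : ∀ {m} {f : Vector ℕ (3 + m)} → Class₁.Good f →
                   f zero ≢ 2 + m → f (suc zero) ≢ 2 + m → f ≗ forced₁ m
lateMax₁⇒forced₁ {m} {f} (perm , ¬123 , ¬132 , ¬3241) f₀ f₁ =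
  ∷ʳ-unique (decreasing⇒countdown init-decreasing init-below) last≡max
  where
  p : Fin (3 + m)
  p = suc (suc (proj₁ (late-max-position perm f₀ f₁)))
  fp : f p ≡ 2 + m
  fp = proj₂ (late-max-position perm f₀ f₁)
  below : ∀ {i} → i ≢ p → f i < f p
  below {i} i≢p = subst (f i <_) (sym fp) (below-max perm fp i≢p)
  falls : ∀ {i j} → i <ᶠ j → i <ᶠ p → j ≢ p → f j < f i
  falls {i} {j} i<j i<p j≢p with compare perm i<j | Fin.<-cmp j p
  ... | inj₂ fj<fi | _            = fj<fi
  ... | inj₁ fi<fj | tri< j<p _ _ = ⊥-elim (¬123 (occurs-123 i<j j<p fi<fj (below j≢p)))
  ... | inj₁ _     | tri≈ _ j≡p _ = ⊥-elim (j≢p j≡p)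
  ... | inj₁ fi<fj | tri> _ _ p<j = ⊥-elim (¬132 (occurs-132 i<p p<j fi<fj (below j≢p)))
  nothing-after : ∀ {q} → ¬ p <ᶠ q
  nothing-after {q} p<q = ¬3241 (occurs-3241 {x = zero} {suc zero} z<s (s<s z<s) p<q
    (falls (<-trans (s<s z<s) p<q) (s<s z<s) (λ q≡p → Fin.<⇒≢ p<q (sym q≡p)))
    (falls z<s z<s λ ())
    (below λ ()))
  p≡last : p ≡ fromℕ (2 + m)
  p≡last = last-position nothing-after
  inject₁≢p : ∀ a → inject₁ a ≢ p
  inject₁≢p a eq = Fin.<⇒≢ (inject₁<fromℕ a) (trans eq p≡last)
  init-decreasing : (f ∘ inject₁) Preserves _<ᶠ_ ⟶ _>_
  init-decreasing {a} {b} a<b =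
    falls (inject₁-mono a<b) (subst (inject₁ a <ᶠ_) (sym p≡last) (inject₁<fromℕ a)) (inject₁≢p b)
  init-below : ∀ a → f (inject₁ a) < 2 + m
  init-below a = below-max perm fp (inject₁≢p a)
  last≡max : f (fromℕ (2 + m)) ≡ 2 + m
  last≡max = subst (λ i → f i ≡ 2 + m) p≡last fp

lateMax₁-card : ∀ m → HasCard (Class₁.LateMax (suc m)) 1
lateMax₁-card m = HasCard-singleton (forced₁ m , forced₁-lateMax m)
  λ (f , G , f₀ , f₁) → lateMax₁⇒forced₁ G f₀ f₁

-- S_n(132, 213, 2341)

module Class₂ = AvoidanceClass p132 p213 p2341
  (from-yes (isPerm? p132)) (from-yes (isPerm? p213)) (from-yes (isPerm? p2341))
  z<s (s<s z<s) (s<s z<s)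

toℕ-lateMax : ∀ m → Class₂.Good (toℕ {3 + m}) × 0 ≢ 2 + m × 1 ≢ 2 + m
toℕ-lateMax m =
  (toℕ-isPermutation ,
   descent-avoided id {suc zero} {suc (suc zero)} (s<s z<s) (s<s z<s) ,
   descent-avoided id {zero} {suc zero} z<s z<s ,
   descent-avoided id {suc (suc zero)} {suc (suc (suc zero))} (s<s (s<s z<s)) z<s) ,
  (λ ()) , (λ ())

lateMax₂⇒toℕ : ∀ {m} {f : Vector ℕ (3 + m)} → Class₂.Good f →
               f zero ≢ 2 + m → f (suc zero) ≢ 2 + m → f ≗ toℕ
lateMax₂⇒toℕ {m} {f} (perm , ¬132 , ¬213 , ¬2341) f₀ f₁ = increasing⇒toℕ increasing (bounded perm)
  where
  p : Fin (3 + m)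
  p = suc (suc (proj₁ (late-max-position perm f₀ f₁)))
  fp : f p ≡ 2 + m
  fp = proj₂ (late-max-position perm f₀ f₁)
  below : ∀ {i} → i ≢ p → f i < f p
  below {i} i≢p = subst (f i <_) (sym fp) (below-max perm fp i≢p)
  rises-before : ∀ {i j} → i <ᶠ j → j <ᶠ p → f i < f j
  rises-before i<j j<p with compare perm i<j
  ... | inj₁ fi<fj = fi<fj
  ... | inj₂ fj<fi = ⊥-elim (¬213 (occurs-213 i<j j<p fj<fi (below (Fin.<⇒≢ (<-trans i<j j<p)))))
  falls-after : ∀ {i j} → i <ᶠ p → p <ᶠ j → f j < f i
  falls-after i<p p<j with compare perm (<-trans i<p p<j)
  ... | inj₂ fj<fi = fj<fi
  ... | inj₁ fi<fj = ⊥-elim (¬132 (occurs-132 i<p p<j fi<fj (below (λ j≡p → Fin.<⇒≢ p<j (sym j≡p)))))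
  nothing-after : ∀ {q} → ¬ p <ᶠ q
  nothing-after p<q = ¬2341 (occurs-2341 {x = zero} {suc zero} z<s (s<s z<s) p<q
    (falls-after z<s p<q) (rises-before z<s (s<s z<s)) (below λ ()))
  increasing : f Preserves _<ᶠ_ ⟶ _<_
  increasing {i} {j} i<j with Fin.<-cmp j p
  ... | tri< j<p _ _  = rises-before i<j j<p
  ... | tri≈ _ refl _ = below (Fin.<⇒≢ i<j)
  ... | tri> _ _ p<j  = ⊥-elim (nothing-after p<j)

lateMax₂-card : ∀ m → HasCard (Class₂.LateMax (suc m)) 1
lateMax₂-card m = HasCard-singleton (toℕ , toℕ-lateMax m)
  λ (f , G , f₀ , f₁) → lateMax₂⇒toℕ G f₀ f₁

theorem3p4 : (n : ℕ) → 1 ≤ n →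
    HasCard (Av₃-setoid n p123 p132 p3241) (fib (n + 2) ∸ 1)
    × HasCard (Av₃-setoid n p132 p213 p2341) (fib (n + 2) ∸ 1)
theorem3p4 zero    ()
theorem3p4 (suc k) _ =
  subst (HasCard _) (count≡fib∸1 k) (Class₁.Counting.Av₃-card (proj₁ ∘ proj₂) lateMax₁-card (suc k)) ,
  subst (HasCard _) (count≡fib∸1 k) (Class₂.Counting.Av₃-card proj₁ lateMax₂-card (suc k))
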